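{- Let \(\mathbb{E}\) be the set of positive even integers, \(N\subseteq\mathbb{E}\), and let \(X\) be an element of \(D_N\) (the universe of \(\mathbf{D}_N\)) with \(\Box\Diamond X=X\), \(\Diamond X\neq W\) and \(\Diamond^2X=W\). Then \(\Diamond(W\setminus X)\neq W\).
   Context: The complex algebra \(\mathsf{Cm}(\langle W;R\rangle)\) is the power set Boolean algebra of \(W\) with \(\Diamond X=\{w\in W\mid w\,R\,x\text{ for some }x\in X\}\) and \(\Box X=W\setminus\Diamond(W\setminus X)\). The frame \(\mathbb{F}_N=\langle W;R_N\rangle\): \(W\) consists of pairwise distinct elements \(a,b_1,b_2,b_3,c_1,c_2,d\), \(u_i\) (\(i\geqslant 1\)) and \(\ell_i\) (\(i\geqslant 0\)); \(R_N\) is the reflexive symmetric relation on \(W\) whose non-loop edges \(\{x,y\}\) are exactly: \(\{a,b_i\}\) for \(i\in\{1,2,3\}\); \(\{b_i,c_i\}\) for \(i\in\{1,2\}\); \(\{c_1,d\}\); \(\{\ell_0,\ell_1\}\); \(\{a,\ell_i\}\) for all \(i\geqslant 0\); \(\{\ell_i,u_i\}\) for all \(i\geqslant 1\); \(\{\ell_i,u_{i-1}\}\) for \(i\in\mathbb{E}\); \(\{\ell_i,u_{i+1}\}\) for \(i\in N\); \(\{\ell_{i+1},u_i\}\) for \(i\in\mathbb{E}\setminus N\). \(\mathbf{D}_N\) is the subalgebra of \(\mathsf{Cm}(\mathbb{F}_N)\) generated by \(\{d\}\), with universe \(D_N\). -}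

module Defs where

open import Data.Nat using (ℕ; zero; suc; _+_; _*_; _∸_)
open import Data.Bool using (Bool; true; false)
open import Data.Product using (Σ; _×_; _,_)
open import Data.Sum using (_⊎_)
open import Data.Unit using (⊤)
open import Data.Empty using (⊥)
open import Relation.Nullary using (¬_)
open import Relation.Binary.PropositionalEquality using (_≡_)

IsE : ℕ → Set
IsE i = Σ ℕ (λ k → i ≡ 2 * suc k)

-- Points of the frame.  u₁₊ k  stands for u_{k+1}  (u_i exists for i ≥ 1);
-- ℓ i stands for ℓ_i (i ≥ 0).
data W : Set where
  a b₁ b₂ b₃ c₁ c₂ d : W
  u₁₊ : ℕ → W
  ℓ   : ℕ → W

-- N ⊆ 𝔼 is given by its characteristic function N : ℕ → Bool.
-- Non-loop edges of F_N (listed once, in one orientation).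
data Edge (N : ℕ → Bool) : W → W → Set where
  a-b₁  : Edge N a b₁
  a-b₂  : Edge N a b₂
  a-b₃  : Edge N a b₃
  b₁-c₁ : Edge N b₁ c₁
  b₂-c₂ : Edge N b₂ c₂
  c₁-d  : Edge N c₁ d
  ℓ₀-ℓ₁ : Edge N (ℓ 0) (ℓ 1)
  a-ℓ   : ∀ i → Edge N a (ℓ i)
  -- {ℓ_i , u_i}, i ≥ 1  (i = k+1)
  ℓ-u   : ∀ k → Edge N (ℓ (suc k)) (u₁₊ k)
  -- {ℓ_i , u_{i-1}}, i ∈ 𝔼  (u_{i-1} = u₁₊ (i ∸ 2))
  ℓ-u⁻  : ∀ i → IsE i → Edge N (ℓ i) (u₁₊ (i ∸ 2))
  -- {ℓ_i , u_{i+1}}, i ∈ N  (u_{i+1} = u₁₊ i)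
  ℓ-u⁺  : ∀ i → N i ≡ true → Edge N (ℓ i) (u₁₊ i)
  -- {ℓ_{i+1} , u_i}, i ∈ 𝔼 ∖ N  (u_i = u₁₊ (i ∸ 1))
  ℓ⁺-u  : ∀ i → IsE i → N i ≡ false → Edge N (ℓ (suc i)) (u₁₊ (i ∸ 1))

R : (N : ℕ → Bool) → W → W → Set
R N x y = (x ≡ y ⊎ Edge N x y) ⊎ Edge N y x

Subset : Set₁
Subset = W → Set

∁ : Subset → Subset
∁ X w = ¬ X w

◇ : (N : ℕ → Bool) → Subset → Subset
◇ N X w = Σ W (λ x → R N w x × X x)

□ : (N : ℕ → Bool) → Subset → Subset
□ N X = ∁ (◇ N (∁ X))

data Term : Set where
  gen : Term
  ⊤t ⊥t : Term
  ∁t ◇t □t : Term → Term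
  _∪t_ _∩t_ : Term → Term → Term

⟦_⟧ : Term → (N : ℕ → Bool) → Subset
⟦ gen ⟧ N w = w ≡ d
⟦ ⊤t ⟧ N w = ⊤
⟦ ⊥t ⟧ N w = ⊥
⟦ ∁t t ⟧ N = ∁ (⟦ t ⟧ N)
⟦ ◇t t ⟧ N = ◇ N (⟦ t ⟧ N)
⟦ □t t ⟧ N = □ N (⟦ t ⟧ N)
⟦ s ∪t t ⟧ N w = ⟦ s ⟧ N w ⊎ ⟦ t ⟧ N w
⟦ s ∩t t ⟧ N w = ⟦ s ⟧ N w × ⟦ t ⟧ N w

_≐_ : Subset → Subset → Set
X ≐ Y = ∀ w → (X w → Y w) × (Y w → X w)

-- Membership in D_N: the subalgebra of Cm(F_N) generated by {d}
-- consists of the subsets denoted by some term.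
InD : (N : ℕ → Bool) → Subset → Set
InD N X = Σ Term (λ t → X ≐ ⟦ t ⟧ N)

IsTotal : Subset → Set
IsTotal X = ∀ w → X w

-- Every element of D_N is eventually constant along the chain ℓ₀, ℓ₁, … and
-- along the chain u₁, u₂, …: this holds for {d} and survives the Boolean
-- operations and ◇, because a far-out ℓ_i or u_i is adjacent only to a and to
-- ℓ_k, u_k with k ≥ i ∸ 2.  The step through ◇ asks whether a belongs to the
-- set, so constructively the invariant holds only under a double negation,
-- which is enough to refute ◇(W ∖ X) = W.
--
-- If a ∈ X then b₃ ∈ □◇X = X, yet b₃ must have a neighbour outside X.  So a ∉ X.
-- If X eventually contains the ℓ's, then □◇X = X eventually contains the u's,
-- and far-out u's have no neighbour outside X.  If X eventually contains the u's
-- but not the ℓ's, then b₃ ∈ ◇²X gives a ∈ ◇X, which puts the far-out ℓ's into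
-- □◇X = X.  If X eventually avoids both chains, so does ◇²X along the u's,
-- contradicting ◇²X = W.
module Submission where

open import Defs
open import Data.Nat using (ℕ; zero; suc; _+_; _∸_; _≤_; _⊔_; z≤n; s≤s)
open import Data.Nat.Properties
  using (≤-refl; ≤-trans; n≤1+n; m≤n⇒m≤1+n; m∸n≤m; m≤m⊔n; m≤n⊔m; m+n≤o⇒m≤o∸n)
open import Data.Bool using (Bool; true)
open import Data.Product using (∃-syntax; _×_; _,_; proj₁; proj₂)
open import Data.Sum using (_⊎_; inj₁; inj₂; [_,_])
open import Data.Unit using (tt)
open import Effect.Monad using (RawMonad)
open import Function using (_∘_)
open import Level using (0ℓ)
open import Relation.Nullary using (¬_; Dec; yes; no; contradiction)
open import Relation.Nullary.Negation using (¬¬-Monad; ¬¬-map)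
open import Relation.Nullary.Decidable using (¬¬-excluded-middle)
open import Relation.Binary.PropositionalEquality using (_≡_; refl)
open import Relation.Unary using (_⊆_)

private
  variable
    P Q : ℕ → Set
    N : ℕ → Bool
    X Y : Subset

Eventually : (ℕ → Set) → Set
Eventually P = ∃[ n ] (∀ i → n ≤ i → P i)

Stabilises : (ℕ → Set) → Set
Stabilises P = Eventually P ⊎ Eventually (¬_ ∘ P)

Eventually-map : (∀ {i} → P i → Q i) → Eventually P → Eventually Q
Eventually-map f (n , h) = n , λ i n≤i → f (h i n≤i)

Eventually-zip : Eventually P → Eventually Q → Eventually (λ i → P i × Q i)
Eventually-zip (m , f) (n , g) =
  m ⊔ n , λ i p → f i (≤-trans (m≤m⊔n m n) p) , g i (≤-trans (m≤n⊔m m n) p)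

Eventually-suc : Eventually P → Eventually (P ∘ suc)
Eventually-suc (n , h) = n , λ i n≤i → h (suc i) (m≤n⇒m≤1+n n≤i)

Eventually-pred : Eventually (P ∘ suc) → Eventually P
Eventually-pred (n , h) = suc n , λ { zero () ; (suc i) (s≤s n≤i) → h i n≤i }

Eventually-lag : ∀ m → Eventually P → Eventually (λ i → ∀ {k} → i ∸ m ≤ k → P k)
Eventually-lag m (n , h) = n + m , λ i n+m≤i i∸m≤k → h _ (≤-trans (m+n≤o⇒m≤o∸n n n+m≤i) i∸m≤k)

Eventually-¬¬ : Eventually P → Eventually (λ i → ¬ ¬ P i)
Eventually-¬¬ = Eventually-map contradiction

Eventually-¬⇒¬∀ : Eventually (¬_ ∘ P) → ¬ (∀ i → P i)
Eventually-¬⇒¬∀ (n , h) all = h n ≤-refl (all n)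

Eventually-¬⇒¬Eventually : Eventually (¬_ ∘ P) → ¬ Eventually P
Eventually-¬⇒¬Eventually ¬p p with Eventually-zip p ¬p
... | n , h = proj₂ (h n ≤-refl) (proj₁ (h n ≤-refl))

Stabilises-map : (∀ {i} → P i → Q i) → (∀ {i} → Q i → P i) → Stabilises P → Stabilises Q
Stabilises-map f _ (inj₁ p)  = inj₁ (Eventually-map f p)
Stabilises-map _ g (inj₂ ¬p) = inj₂ (Eventually-map (_∘ g) ¬p)

Stabilises-¬ : Stabilises P → Stabilises (¬_ ∘ P)
Stabilises-¬ (inj₁ p)  = inj₂ (Eventually-¬¬ p)
Stabilises-¬ (inj₂ ¬p) = inj₁ ¬p

Stabilises-⊎ : Stabilises P → Stabilises Q → Stabilises (λ i → P i ⊎ Q i)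
Stabilises-⊎ (inj₁ p)  _         = inj₁ (Eventually-map inj₁ p)
Stabilises-⊎ (inj₂ _)  (inj₁ q)  = inj₁ (Eventually-map inj₂ q)
Stabilises-⊎ (inj₂ ¬p) (inj₂ ¬q) =
  inj₂ (Eventually-map (λ (¬pᵢ , ¬qᵢ) → [ ¬pᵢ , ¬qᵢ ]) (Eventually-zip ¬p ¬q))

Stabilises-× : Stabilises P → Stabilises Q → Stabilises (λ i → P i × Q i)
Stabilises-× (inj₂ ¬p) _         = inj₂ (Eventually-map (_∘ proj₁) ¬p)
Stabilises-× (inj₁ _)  (inj₂ ¬q) = inj₂ (Eventually-map (_∘ proj₂) ¬q)
Stabilises-× (inj₁ p)  (inj₁ q)  = inj₁ (Eventually-zip p q)

data ℓ-Neighbour (j : ℕ) : W → Set where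
  apex    : ℓ-Neighbour j a
  ℓ-above : ∀ {k} → j ∸ 1 ≤ k → ℓ-Neighbour j (ℓ k)
  u-above : ∀ {k} → j ∸ 2 ≤ k → ℓ-Neighbour j (u₁₊ k)

data u-Neighbour (j : ℕ) : W → Set where
  self    : u-Neighbour j (u₁₊ j)
  ℓ-above : ∀ {k} → j ≤ k → u-Neighbour j (ℓ k)

ℓ-neighbour : ∀ {j x} → R N (ℓ j) x → ℓ-Neighbour j x
ℓ-neighbour {j = j} (inj₁ (inj₁ refl))    = ℓ-above (m∸n≤m j 1)
ℓ-neighbour (inj₁ (inj₂ ℓ₀-ℓ₁))           = ℓ-above z≤n
ℓ-neighbour (inj₁ (inj₂ (ℓ-u k)))         = u-above (m∸n≤m k 1)
ℓ-neighbour (inj₁ (inj₂ (ℓ-u⁻ i _)))      = u-above ≤-refl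
ℓ-neighbour (inj₁ (inj₂ (ℓ-u⁺ i _)))      = u-above (m∸n≤m i 2)
ℓ-neighbour (inj₁ (inj₂ (ℓ⁺-u i _ _)))    = u-above ≤-refl
ℓ-neighbour (inj₂ (a-ℓ i))                = apex
ℓ-neighbour (inj₂ ℓ₀-ℓ₁)                  = ℓ-above z≤n

u-neighbour : ∀ {j x} → R N (u₁₊ j) x → u-Neighbour j x
u-neighbour (inj₁ (inj₁ refl))     = self
u-neighbour (inj₂ (ℓ-u k))         = ℓ-above (n≤1+n k)
u-neighbour (inj₂ (ℓ-u⁻ i _))      = ℓ-above (m∸n≤m i 2)
u-neighbour (inj₂ (ℓ-u⁺ i _))      = ℓ-above ≤-refl
u-neighbour (inj₂ (ℓ⁺-u i _ _))    = ℓ-above (≤-trans (m∸n≤m i 1) (n≤1+n i))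

⊆-◇ : X ⊆ ◇ N X
⊆-◇ x = _ , inj₁ (inj₁ refl) , x

◇-b₃ : ◇ N Y b₃ → Y b₃ ⊎ Y a
◇-b₃ (_ , inj₁ (inj₁ refl) , y) = inj₁ y
◇-b₃ (_ , inj₂ a-b₃ , y)        = inj₂ y

◇-b₃-of-a : Y a → ◇ N Y b₃
◇-b₃-of-a y = a , inj₂ a-b₃ , y

◇-a-of-b₃ : Y b₃ → ◇ N Y a
◇-a-of-b₃ y = b₃ , inj₁ (inj₂ a-b₃) , y

□◇-b₃-of-a : Y a → □ N (◇ N Y) b₃
□◇-b₃-of-a y ◇∁◇Y = [ (λ ∁◇Y-b₃ → ∁◇Y-b₃ (◇-b₃-of-a y)) , (λ ∁◇Y-a → ∁◇Y-a (⊆-◇ y)) ] (◇-b₃ ◇∁◇Y)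

◇²-b₃⇒◇-a : ¬ Y a → ◇ N (◇ N Y) b₃ → ◇ N Y a
◇²-b₃⇒◇-a ¬Ya ◇²Y-b₃ with ◇-b₃ ◇²Y-b₃
... | inj₂ ◇Y-a  = ◇Y-a
... | inj₁ ◇Y-b₃ with ◇-b₃ ◇Y-b₃
...   | inj₁ Y-b₃ = ◇-a-of-b₃ Y-b₃
...   | inj₂ Y-a  = contradiction Y-a ¬Ya

◇-ℓ-of-a : Y a → ∀ i → ◇ N Y (ℓ i)
◇-ℓ-of-a y i = a , inj₂ (a-ℓ i) , y

◇-u-of-ℓ : Eventually (Y ∘ ℓ) → Eventually (◇ N Y ∘ u₁₊)
◇-u-of-ℓ = Eventually-map (λ {k} y → ℓ (suc k) , inj₂ (ℓ-u k) , y) ∘ Eventually-suc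

◇-ℓ-of-u : Eventually (Y ∘ u₁₊) → Eventually (◇ N Y ∘ ℓ)
◇-ℓ-of-u = Eventually-pred ∘ Eventually-map (λ {k} y → u₁₊ k , inj₁ (inj₂ (ℓ-u k)) , y)

◇-avoids-u : Eventually (∁ Y ∘ ℓ) → Eventually (∁ Y ∘ u₁₊) → Eventually (∁ (◇ N Y) ∘ u₁₊)
◇-avoids-u {Y = Y} {N = N} ¬ℓ ¬u =
  Eventually-map avoid (Eventually-zip (Eventually-lag 0 ¬ℓ) ¬u)
  where
  avoid : ∀ {j} → (∀ {k} → j ≤ k → ¬ Y (ℓ k)) × ¬ Y (u₁₊ j) → ¬ ◇ N Y (u₁₊ j)
  avoid (¬ℓ-above , ¬self) (_ , r , y) with u-neighbour r
  ... | self        = ¬self y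
  ... | ℓ-above j≤k = ¬ℓ-above j≤k y

◇-avoids-ℓ : ¬ Y a → Eventually (∁ Y ∘ ℓ) → Eventually (∁ Y ∘ u₁₊) →
             Eventually (∁ (◇ N Y) ∘ ℓ)
◇-avoids-ℓ {Y = Y} {N = N} ¬Ya ¬ℓ ¬u =
  Eventually-map avoid (Eventually-zip (Eventually-lag 1 ¬ℓ) (Eventually-lag 2 ¬u))
  where
  avoid : ∀ {j} → (∀ {k} → j ∸ 1 ≤ k → ¬ Y (ℓ k)) × (∀ {k} → j ∸ 2 ≤ k → ¬ Y (u₁₊ k)) →
          ¬ ◇ N Y (ℓ j)
  avoid (¬ℓ-above , ¬u-above) (_ , r , y) with ℓ-neighbour r
  ... | apex          = ¬Ya y
  ... | ℓ-above j∸1≤k = ¬ℓ-above j∸1≤k y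
  ... | u-above j∸2≤k = ¬u-above j∸2≤k y

□-u : Eventually (Y ∘ ℓ) → Eventually (Y ∘ u₁₊) → Eventually (□ N Y ∘ u₁₊)
□-u yℓ yu = ◇-avoids-u (Eventually-¬¬ yℓ) (Eventually-¬¬ yu)

□-ℓ : Y a → Eventually (Y ∘ ℓ) → Eventually (Y ∘ u₁₊) → Eventually (□ N Y ∘ ℓ)
□-ℓ ya yℓ yu = ◇-avoids-ℓ (contradiction ya) (Eventually-¬¬ yℓ) (Eventually-¬¬ yu)

record Tame (X : Subset) : Set where
  constructor tame
  field
    along-ℓ : Stabilises (X ∘ ℓ)
    along-u : Stabilises (X ∘ u₁₊)

≐-sym : X ≐ Y → Y ≐ X
≐-sym X≐Y w = proj₂ (X≐Y w) , proj₁ (X≐Y w)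

Tame-resp-≐ : X ≐ Y → Tame X → Tame Y
Tame-resp-≐ X≐Y (tame sℓ su) = tame
  (Stabilises-map (proj₁ (X≐Y _)) (proj₂ (X≐Y _)) sℓ)
  (Stabilises-map (proj₁ (X≐Y _)) (proj₂ (X≐Y _)) su)

Tame-∁ : Tame X → Tame (∁ X)
Tame-∁ (tame sℓ su) = tame (Stabilises-¬ sℓ) (Stabilises-¬ su)

Tame-∪ : Tame X → Tame Y → Tame (λ w → X w ⊎ Y w)
Tame-∪ (tame sℓ su) (tame tℓ tu) = tame (Stabilises-⊎ sℓ tℓ) (Stabilises-⊎ su tu)

Tame-∩ : Tame X → Tame Y → Tame (λ w → X w × Y w)
Tame-∩ (tame sℓ su) (tame tℓ tu) = tame (Stabilises-× sℓ tℓ) (Stabilises-× su tu)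

Tame-◇ : Dec (Y a) → Tame Y → Tame (◇ N Y)
Tame-◇ {Y = Y} {N = N} Ya? (tame sℓ su) = tame (stable-ℓ Ya? sℓ su) (stable-u sℓ su)
  where
  stable-ℓ : Dec (Y a) → Stabilises (Y ∘ ℓ) → Stabilises (Y ∘ u₁₊) → Stabilises (◇ N Y ∘ ℓ)
  stable-ℓ (yes ya)  _         _         = inj₁ (0 , λ i _ → ◇-ℓ-of-a ya i)
  stable-ℓ (no _)    (inj₁ yℓ) _         = inj₁ (Eventually-map ⊆-◇ yℓ)
  stable-ℓ (no _)    (inj₂ _)  (inj₁ yu) = inj₁ (◇-ℓ-of-u yu)
  stable-ℓ (no ¬ya)  (inj₂ ¬ℓ) (inj₂ ¬u) = inj₂ (◇-avoids-ℓ ¬ya ¬ℓ ¬u)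

  stable-u : Stabilises (Y ∘ ℓ) → Stabilises (Y ∘ u₁₊) → Stabilises (◇ N Y ∘ u₁₊)
  stable-u (inj₁ yℓ) _         = inj₁ (◇-u-of-ℓ yℓ)
  stable-u (inj₂ _)  (inj₁ yu) = inj₁ (Eventually-map ⊆-◇ yu)
  stable-u (inj₂ ¬ℓ) (inj₂ ¬u) = inj₂ (◇-avoids-u ¬ℓ ¬u)

module _ (N : ℕ → Bool) where
  open RawMonad (¬¬-Monad {0ℓ})

  ⟦⟧-tame : ∀ t → ¬ ¬ Tame (⟦ t ⟧ N)
  ⟦⟧-tame gen      = pure (tame (inj₂ (0 , λ _ _ ())) (inj₂ (0 , λ _ _ ())))
  ⟦⟧-tame ⊤t       = pure (tame (inj₁ (0 , λ _ _ → tt)) (inj₁ (0 , λ _ _ → tt)))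
  ⟦⟧-tame ⊥t       = pure (tame (inj₂ (0 , λ _ _ z → z)) (inj₂ (0 , λ _ _ z → z)))
  ⟦⟧-tame (∁t t)   = Tame-∁ <$> ⟦⟧-tame t
  ⟦⟧-tame (◇t t)   = zipWith Tame-◇ ¬¬-excluded-middle (⟦⟧-tame t)
  ⟦⟧-tame (□t t)   = zipWith (λ Ya? → Tame-∁ ∘ Tame-◇ Ya? ∘ Tame-∁) ¬¬-excluded-middle (⟦⟧-tame t)
  ⟦⟧-tame (s ∪t t) = zipWith Tame-∪ (⟦⟧-tame s) (⟦⟧-tame t)
  ⟦⟧-tame (s ∩t t) = zipWith Tame-∩ (⟦⟧-tame s) (⟦⟧-tame t)

module _ {X : Subset} (□◇X⊆X : □ N (◇ N X) ⊆ X) where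

  a∉X : IsTotal (◇ N (∁ X)) → ¬ X a
  a∉X ◇∁X-total Xa with ◇-b₃ (◇∁X-total b₃)
  ... | inj₁ ∁X-b₃ = ∁X-b₃ (□◇X⊆X (□◇-b₃-of-a Xa))
  ... | inj₂ ∁X-a  = ∁X-a Xa

  ¬Eventually-ℓ : IsTotal (◇ N (∁ X)) → ¬ Eventually (X ∘ ℓ)
  ¬Eventually-ℓ ◇∁X-total Xℓ =
    Eventually-¬⇒¬∀ (◇-avoids-u (Eventually-¬¬ Xℓ) (Eventually-¬¬ Xu)) (◇∁X-total ∘ u₁₊)
    where
    Xu : Eventually (X ∘ u₁₊)
    Xu = Eventually-map □◇X⊆X (□-u (Eventually-map ⊆-◇ Xℓ) (◇-u-of-ℓ Xℓ))

  Eventually-u⇒Eventually-ℓ : ¬ X a → IsTotal (◇ N (◇ N X)) →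
                              Eventually (X ∘ u₁₊) → Eventually (X ∘ ℓ)
  Eventually-u⇒Eventually-ℓ ¬Xa ◇²X-total Xu = Eventually-map □◇X⊆X
    (□-ℓ (◇²-b₃⇒◇-a ¬Xa (◇²X-total b₃)) (◇-ℓ-of-u Xu) (Eventually-map ⊆-◇ Xu))

◇²-not-total : ¬ X a → Eventually (∁ X ∘ ℓ) → Eventually (∁ X ∘ u₁₊) →
               ¬ IsTotal (◇ N (◇ N X))
◇²-not-total ¬Xa ¬ℓ ¬u ◇²X-total =
  Eventually-¬⇒¬∀ (◇-avoids-u (◇-avoids-ℓ ¬Xa ¬ℓ ¬u) (◇-avoids-u ¬ℓ ¬u)) (◇²X-total ∘ u₁₊)

lemma3p10 : (N : ℕ → Bool) → (∀ i → N i ≡ true → IsE i) →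
    (X : Subset) → InD N X →
    □ N (◇ N X) ≐ X →
    ¬ IsTotal (◇ N X) →
    IsTotal (◇ N (◇ N X)) →
    ¬ IsTotal (◇ N (∁ X))
lemma3p10 N _ X (t , X≐t) □◇X≐X _ ◇²X-total ◇∁X-total =
  ¬¬-map (Tame-resp-≐ (≐-sym X≐t)) (⟦⟧-tame N t) λ where
    (tame (inj₁ Xℓ) _)         → ¬Eventually-ℓ □◇X⊆X ◇∁X-total Xℓ
    (tame (inj₂ ¬ℓ) (inj₁ Xu)) →
      Eventually-¬⇒¬Eventually ¬ℓ (Eventually-u⇒Eventually-ℓ □◇X⊆X ¬Xa ◇²X-total Xu)
    (tame (inj₂ ¬ℓ) (inj₂ ¬u)) → ◇²-not-total ¬Xa ¬ℓ ¬u ◇²X-total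
  where
  □◇X⊆X : □ N (◇ N X) ⊆ X
  □◇X⊆X = proj₁ (□◇X≐X _)

  ¬Xa : ¬ X a
  ¬Xa = a∉X □◇X⊆X ◇∁X-total
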